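{- Let $(a(n))_{n\ge0}$ be the increasing enumeration (indexed from $0$) of the odious numbers (nonnegative integers with odd binary digit sum), and let $(t(n))_{n\ge0}$ be the Thue–Morse sequence ($t(0)=0$, $t(2n)=t(n)$, $t(2n+1)=1-t(n)$). If $n,m\ge0$ are both odd or both even, then $a(n)<_4 a(m)$ if and only if $t(m)<t(n)$, and $a(n)\le_4 a(m)$ if and only if $t(m)\le t(n)$.
   Context: For integers $x,y$, write $x<_4 y$ (resp. $x\le_4 y$) if the residues $\overline{x},\overline{y}\in\{0,1,2,3\}$ of $x$ and $y$ modulo $4$, considered as natural integers, satisfy $\overline{x}<\overline{y}$ (resp. $\overline{x}\le\overline{y}$). -}

module Defs where

open import Data.Nat using (ℕ; zero; suc; _+_; _<_; _≤_; _%_; ⌊_/2⌋)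
open import Data.Bool using (Bool; true; false; not)
open import Data.Product using (∃; _×_)
open import Relation.Binary.PropositionalEquality using (_≡_)

-- Binary digit sum s₂(n), computed with fuel (fuel ≥ n suffices).
digitSumAux : ℕ → ℕ → ℕ
digitSumAux zero    n = 0
digitSumAux (suc f) zero = 0
digitSumAux (suc f) n@(suc _) = (n % 2) + digitSumAux f ⌊ n /2⌋

digitSum : ℕ → ℕ
digitSum n = digitSumAux n n

Odious : ℕ → Set
Odious n = digitSum n % 2 ≡ 1

IsOdiousEnumeration : (ℕ → ℕ) → Set
IsOdiousEnumeration a =
  (∀ n → a n < a (suc n)) × (∀ n → Odious (a n)) × (∀ k → Odious k → ∃ λ n → a n ≡ k)

tmAux : ℕ → ℕ → Bool
tmAux zero    n = false
tmAux (suc f) zero = false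
tmAux (suc f) n@(suc _) with n % 2
... | 0 = tmAux f ⌊ n /2⌋
... | _ = not (tmAux f ⌊ n /2⌋)

tmB : ℕ → Bool
tmB n = tmAux n n

t : ℕ → ℕ
t n with tmB n
... | false = 0
... | true  = 1

_<₄_ : ℕ → ℕ → Set
x <₄ y = x % 4 < y % 4

_≤₄_ : ℕ → ℕ → Set
x ≤₄ y = x % 4 ≤ y % 4

SameParity : ℕ → ℕ → Set
SameParity n m = n % 2 ≡ m % 2

{-# OPTIONS --safe #-}

-- Since t(2n) = t(n) and t(2n+1) = 1 - t(n), exactly one of 2n and 2n+1 is odious, namely
-- 2n when t(n) = 1 and 2n+1 when t(n) = 0; hence a(n) = 2n + 1 - t(n). Modulo 4 this gives
-- a(n) ≡ 1 - t(n) for even n and a(n) ≡ 3 - t(n) for odd n, so a(n) mod 4 + t(n) depends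
-- only on the parity of n, and comparing the residues of a(n), a(m) is comparing t(m), t(n).
module Submission where

open import Defs
open import Data.Nat using (ℕ; zero; suc; _+_; _*_; _<_; _≤_; _%_; ⌊_/2⌋; z≤n; s≤s)
open import Data.Nat.Properties
open import Data.Nat.DivMod using (m%n<n; [m+kn]%n≡m%n; m%n*o≡m*o%[n*o]; [m*n+o]%[p*n]≡[m*n]%[p*n]+o)
open import Data.Bool using (Bool; true; false; not; if_then_else_)
open import Data.Bool.Properties using (not-injective)
open import Data.Product using (_×_; _,_; ∃; proj₁; proj₂; map₂)
open import Data.Sum using (inj₁; inj₂)
open import Function.Bundles using (_⇔_; mk⇔; Equivalence)
open import Relation.Binary.Core using (_Preserves_⟶_)
open import Relation.Nullary using (yes; no; contradiction)
open import Relation.Binary.PropositionalEquality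

data Halving : ℕ → Set where
  even : ∀ k → Halving (k + k)
  odd  : ∀ k → Halving (suc (k + k))

halving : ∀ n → Halving n
halving zero = even 0
halving (suc n) with halving n
... | even k = odd k
... | odd k  = subst Halving (cong suc (+-suc k k)) (even (suc k))

n+n≡n*2 : ∀ n → n + n ≡ n * 2
n+n≡n*2 n = sym (trans (*-suc n 1) (cong (n +_) (*-identityʳ n)))

[n+n]%2≡0 : ∀ n → (n + n) % 2 ≡ 0
[n+n]%2≡0 n = trans (cong (_% 2) (n+n≡n*2 n)) ([m+kn]%n≡m%n 0 n 2)

[1+n+n]%2≡1 : ∀ n → suc (n + n) % 2 ≡ 1
[1+n+n]%2≡1 n = trans (cong (λ m → suc m % 2) (n+n≡n*2 n)) ([m+kn]%n≡m%n 1 n 2)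

[n+n]%4≡[n%2]*2 : ∀ n → (n + n) % 4 ≡ n % 2 * 2
[n+n]%4≡[n%2]*2 n = trans (cong (_% 4) (n+n≡n*2 n)) (sym (m%n*o≡m*o%[n*o] n 2 2))

[1+n+n]%4≡1+[n%2]*2 : ∀ n → suc (n + n) % 4 ≡ 1 + n % 2 * 2
[1+n+n]%4≡1+[n%2]*2 n = begin
  suc (n + n) % 4      ≡⟨ cong (_% 4) (+-comm 1 (n + n)) ⟩
  (n + n + 1) % 4      ≡⟨ cong (λ m → (m + 1) % 4) (n+n≡n*2 n) ⟩
  (n * 2 + 1) % 4      ≡⟨ [m*n+o]%[p*n]≡[m*n]%[p*n]+o n 2 (s≤s (s≤s z≤n)) ⟩
  n * 2 % 4 + 1        ≡⟨ cong (_+ 1) (sym (m%n*o≡m*o%[n*o] n 2 2)) ⟩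
  n % 2 * 2 + 1        ≡⟨ +-comm (n % 2 * 2) 1 ⟩
  1 + n % 2 * 2        ∎
  where open ≡-Reasoning

StrictlyIncreasing : (ℕ → ℕ) → Set
StrictlyIncreasing h = ∀ n → h n < h (suc n)

module _ {h : ℕ → ℕ} (h↑ : StrictlyIncreasing h) where

  strictlyIncreasing⇒<-mono : h Preserves _<_ ⟶ _<_
  strictlyIncreasing⇒<-mono {i} {suc j} (s≤s i≤j) with m≤n⇒m<n∨m≡n i≤j
  ... | inj₁ i<j  = <-trans (strictlyIncreasing⇒<-mono i<j) (h↑ j)
  ... | inj₂ refl = h↑ i

  strictlyIncreasing⇒≤-mono : h Preserves _≤_ ⟶ _≤_
  strictlyIncreasing⇒≤-mono i≤j with m≤n⇒m<n∨m≡n i≤j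
  ... | inj₁ i<j  = <⇒≤ (strictlyIncreasing⇒<-mono i<j)
  ... | inj₂ refl = ≤-refl

  strictlyIncreasing⇒<-reflect : ∀ {i j} → h i < h j → i < j
  strictlyIncreasing⇒<-reflect {i} {j} hi<hj with i <? j
  ... | yes i<j = i<j
  ... | no  i≮j = contradiction hi<hj (≤⇒≯ (strictlyIncreasing⇒≤-mono (≮⇒≥ i≮j)))

  strictlyIncreasing⇒inflationary : ∀ n → n ≤ h n
  strictlyIncreasing⇒inflationary zero    = z≤n
  strictlyIncreasing⇒inflationary (suc n) = <-≤-trans (s≤s (strictlyIncreasing⇒inflationary n)) (h↑ n)

-- The index of `a n` in `b` grows strictly with `n`, hence is at least `n`.
range⊆⇒≥ : ∀ {a b} → StrictlyIncreasing a → StrictlyIncreasing b →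
           (∀ n → ∃ λ i → a n ≡ b i) → ∀ n → b n ≤ a n
range⊆⇒≥ {a} {b} a↑ b↑ a⊆b n = begin
  b n          ≤⟨ strictlyIncreasing⇒≤-mono b↑ (strictlyIncreasing⇒inflationary index↑ n) ⟩
  b (index n)  ≡⟨ sym (proj₂ (a⊆b n)) ⟩
  a n          ∎
  where
  open ≤-Reasoning
  index : ℕ → ℕ
  index n = proj₁ (a⊆b n)
  index↑ : StrictlyIncreasing index
  index↑ n = strictlyIncreasing⇒<-reflect b↑
    (subst₂ _<_ (proj₂ (a⊆b n)) (proj₂ (a⊆b (suc n))) (a↑ n))

sameRange⇒≗ : ∀ {a b} → StrictlyIncreasing a → StrictlyIncreasing b →
              (∀ n → ∃ λ i → a n ≡ b i) → (∀ n → ∃ λ i → b n ≡ a i) → ∀ n → a n ≡ b n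
sameRange⇒≗ a↑ b↑ a⊆b b⊆a n = ≤-antisym (range⊆⇒≥ b↑ a↑ b⊆a n) (range⊆⇒≥ a↑ b↑ a⊆b n)

exchange-< : ∀ {x y u v} → x + u ≡ y + v → x < y → v < u
exchange-< {x} {y} {u} {v} eq x<y = +-cancelˡ-< y v u (begin-strict
  y + v  ≡⟨ sym eq ⟩
  x + u  <⟨ +-monoˡ-< u x<y ⟩
  y + u  ∎)
  where open ≤-Reasoning

exchange-≤ : ∀ {x y u v} → x + u ≡ y + v → x ≤ y → v ≤ u
exchange-≤ {x} {y} {u} {v} eq x≤y = +-cancelˡ-≤ y v u (begin
  y + v  ≡⟨ sym eq ⟩
  x + u  ≤⟨ +-monoˡ-≤ u x≤y ⟩
  y + u  ∎)
  where open ≤-Reasoning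

exchange-comparisons : ∀ {x y u v} → x + u ≡ y + v → ((x < y) ⇔ (v < u)) × ((x ≤ y) ⇔ (v ≤ u))
exchange-comparisons {x} {y} {u} {v} eq =
  mk⇔ (exchange-< eq) (exchange-< swapped) , mk⇔ (exchange-≤ eq) (exchange-≤ swapped)
  where
  swapped : v + y ≡ u + x
  swapped = trans (+-comm v y) (trans (sym eq) (+-comm x u))

-- Mirrors the branch on `n % 2` in `tmAux`.
negateIfNonzero : ℕ → Bool → Bool
negateIfNonzero zero    b = b
negateIfNonzero (suc _) b = not b

tmAux-unfold : ∀ f m → tmAux (suc f) (suc m) ≡ negateIfNonzero (suc m % 2) (tmAux f ⌊ suc m /2⌋)
tmAux-unfold f m with suc m % 2
... | zero  = refl
... | suc _ = refl

tmAux-fuel-irrelevant : ∀ f g n → n ≤ f → n ≤ g → tmAux f n ≡ tmAux g n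
tmAux-fuel-irrelevant zero    zero    zero    _   _   = refl
tmAux-fuel-irrelevant zero    (suc g) zero    _   _   = refl
tmAux-fuel-irrelevant (suc f) zero    zero    _   _   = refl
tmAux-fuel-irrelevant (suc f) (suc g) zero    _   _   = refl
tmAux-fuel-irrelevant (suc f) (suc g) (suc m) m<f m<g = begin
  tmAux (suc f) (suc m)                              ≡⟨ tmAux-unfold f m ⟩
  negateIfNonzero (suc m % 2) (tmAux f ⌊ suc m /2⌋) ≡⟨ cong (negateIfNonzero (suc m % 2))
                                                          (tmAux-fuel-irrelevant f g _ (half≤ m<f) (half≤ m<g)) ⟩
  negateIfNonzero (suc m % 2) (tmAux g ⌊ suc m /2⌋) ≡⟨ tmAux-unfold g m ⟨
  tmAux (suc g) (suc m)                              ∎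
  where
  open ≡-Reasoning
  half≤ : ∀ {h} → suc m ≤ suc h → ⌊ suc m /2⌋ ≤ h
  half≤ m≤h = ≤-pred (<-≤-trans (⌊n/2⌋<n m) m≤h)

tmB-suc : ∀ m → tmB (suc m) ≡ negateIfNonzero (suc m % 2) (tmB ⌊ suc m /2⌋)
tmB-suc m = trans (tmAux-unfold m m) (cong (negateIfNonzero (suc m % 2))
  (tmAux-fuel-irrelevant m ⌊ suc m /2⌋ ⌊ suc m /2⌋ (≤-pred (⌊n/2⌋<n m)) ≤-refl))

tmB-double : ∀ n → tmB (n + n) ≡ tmB n
tmB-double zero    = refl
tmB-double (suc k) = trans (tmB-suc (k + suc k))
  (cong₂ negateIfNonzero ([n+n]%2≡0 (suc k)) (cong tmB (sym (n≡⌊n+n/2⌋ (suc k)))))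

tmB-suc-double : ∀ n → tmB (suc (n + n)) ≡ not (tmB n)
tmB-suc-double n = trans (tmB-suc (n + n))
  (cong₂ negateIfNonzero ([1+n+n]%2≡1 n) (cong tmB (sym (n≡⌈n+n/2⌉ n))))

toℕ : Bool → ℕ
toℕ false = 0
toℕ true  = 1

suc-%2-flips : ∀ d b → d % 2 ≡ toℕ b → suc d % 2 ≡ toℕ (not b)
suc-%2-flips zero          false _  = refl
suc-%2-flips (suc zero)    true  _  = refl
suc-%2-flips (suc (suc d)) b     eq = suc-%2-flips d b eq

digitSumAux-parity : ∀ f n → digitSumAux f n % 2 ≡ toℕ (tmAux f n)
digitSumAux-parity zero    n       = refl
digitSumAux-parity (suc f) zero    = refl
digitSumAux-parity (suc f) (suc m) with suc m % 2 | m%n<n (suc m) 2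
... | zero        | _ = digitSumAux-parity f ⌊ suc m /2⌋
... | suc zero    | _ = suc-%2-flips (digitSumAux f ⌊ suc m /2⌋) _ (digitSumAux-parity f ⌊ suc m /2⌋)
... | suc (suc _) | s≤s (s≤s ())

odious⇔tmB : ∀ n → Odious n ⇔ tmB n ≡ true
odious⇔tmB n = mk⇔ to (λ tm → trans (digitSumAux-parity n n) (cong toℕ tm))
  where
  to : Odious n → tmB n ≡ true
  to odious with tmB n | digitSumAux-parity n n
  ... | true  | _      = refl
  ... | false | parity = contradiction (trans (sym parity) odious) 0≢1+n

nthOdious : ℕ → ℕ
nthOdious n = if tmB n then n + n else suc (n + n)

nthOdious-odious : ∀ n → tmB (nthOdious n) ≡ true
nthOdious-odious n with tmB n in eq
... | true  = trans (tmB-double n) eq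
... | false = trans (tmB-suc-double n) (cong not eq)

n+n≤nthOdious : ∀ n → n + n ≤ nthOdious n
n+n≤nthOdious n with tmB n
... | true  = ≤-refl
... | false = n≤1+n (n + n)

nthOdious≤1+n+n : ∀ n → nthOdious n ≤ suc (n + n)
nthOdious≤1+n+n n with tmB n
... | true  = n≤1+n (n + n)
... | false = ≤-refl

nthOdious-increasing : StrictlyIncreasing nthOdious
nthOdious-increasing n = begin-strict
  nthOdious n            ≤⟨ nthOdious≤1+n+n n ⟩
  suc (n + n)            <⟨ s≤s (≤-reflexive (sym (+-suc n n))) ⟩
  suc n + suc n          ≤⟨ n+n≤nthOdious (suc n) ⟩
  nthOdious (suc n)      ∎
  where open ≤-Reasoning

nthOdious-of-true : ∀ n → tmB n ≡ true → nthOdious n ≡ n + n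
nthOdious-of-true n eq rewrite eq = refl

nthOdious-of-false : ∀ n → tmB n ≡ false → nthOdious n ≡ suc (n + n)
nthOdious-of-false n eq rewrite eq = refl

nthOdious-covers : ∀ x → tmB x ≡ true → ∃ λ j → x ≡ nthOdious j
nthOdious-covers x odious with halving x
... | even k = k , sym (nthOdious-of-true k (trans (sym (tmB-double k)) odious))
... | odd k  = k , sym (nthOdious-of-false k
                         (not-injective {y = false} (trans (sym (tmB-suc-double k)) odious)))

nthOdious%4+t : ∀ n → nthOdious n % 4 + t n ≡ 1 + n % 2 * 2
nthOdious%4+t n with tmB n
... | true  = trans (cong (_+ 1) ([n+n]%4≡[n%2]*2 n)) (+-comm (n % 2 * 2) 1)
... | false = trans (+-identityʳ _) ([1+n+n]%4≡1+[n%2]*2 n)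

odiousEnumeration≗nthOdious : ∀ {a} → IsOdiousEnumeration a → ∀ n → a n ≡ nthOdious n
odiousEnumeration≗nthOdious {a} (a↑ , a-odious , a-covers) =
  sameRange⇒≗ a↑ nthOdious-increasing
    (λ n → nthOdious-covers (a n) (Equivalence.to (odious⇔tmB (a n)) (a-odious n)))
    (λ n → map₂ sym (a-covers (nthOdious n)
                       (Equivalence.from (odious⇔tmB (nthOdious n)) (nthOdious-odious n))))

lemma4p3 : (a : ℕ → ℕ) → IsOdiousEnumeration a → (n m : ℕ) → SameParity n m →
    ((a n <₄ a m) ⇔ (t m < t n)) × ((a n ≤₄ a m) ⇔ (t m ≤ t n))
lemma4p3 a enumeration n m sameParity = exchange-comparisons (begin
  a n % 4 + t n  ≡⟨ residue n ⟩
  1 + n % 2 * 2  ≡⟨ cong (λ r → 1 + r * 2) sameParity ⟩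
  1 + m % 2 * 2  ≡⟨ residue m ⟨
  a m % 4 + t m  ∎)
  where
  open ≡-Reasoning
  residue : ∀ k → a k % 4 + t k ≡ 1 + k % 2 * 2
  residue k = trans (cong (λ x → x % 4 + t k) (odiousEnumeration≗nthOdious enumeration k))
                    (nthOdious%4+t k)
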